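{- Let $e \ge 1$ and $2 \le m \le n$. The Cartesian product $P_m \square P_n$ admits an $e$-quasi-perfect code if one of the following holds: (i) $m = n = 2e+3$; (ii) $m = e+1$ and $n = e+3$.
   Context: All graphs are simple and connected; $d(x,y)$ is the shortest-path distance. $P_n$ is the path on $n$ vertices. The Cartesian product $G\square H$ has vertex set $V(G)\times V(H)$, with $(g_1,h_1)$ adjacent to $(g_2,h_2)$ iff either $h_1=h_2$ and $g_1g_2\in E(G)$, or $g_1=g_2$ and $h_1h_2\in E(H)$. A code is a subset $D$ of the vertex set. $D$ is $t$-error-correcting if any two distinct codewords are at distance at least $2t+1$. The covering radius of $D$ is the smallest $r$ such that every vertex is at distance at most $r$ from some codeword. $D$ is $t$-quasi-perfect if it is $t$-error-correcting with covering radius $t+1$. -}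

module Defs where

open import Data.Nat using (ℕ; zero; suc; _+_; _*_; _≤_)
open import Data.Fin using (Fin; toℕ)
open import Data.Product using (_×_; _,_; Σ; ∃; ∃-syntax)
open import Data.Sum using (_⊎_)
open import Relation.Binary.PropositionalEquality using (_≡_)
open import Relation.Nullary using (¬_)

record Graph : Set₁ where
  field
    V   : Set
    Adj : V → V → Set

open Graph public

P : ℕ → Graph
P n = record { V = Fin n ; Adj = λ i j → (suc (toℕ i) ≡ toℕ j) ⊎ (suc (toℕ j) ≡ toℕ i) }

_□_ : Graph → Graph → Graph
G □ H = record
  { V   = V G × V H
  ; Adj = λ { (g₁ , h₁) (g₂ , h₂) → (h₁ ≡ h₂ × Adj G g₁ g₂) ⊎ (g₁ ≡ g₂ × Adj H h₁ h₂) } }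

data Walk (G : Graph) : V G → V G → ℕ → Set where
  here : ∀ {x} → Walk G x x 0
  step : ∀ {x y z k} → Adj G x y → Walk G y z k → Walk G x z (suc k)

DistLe : (G : Graph) → ℕ → V G → V G → Set
DistLe G k x y = ∃[ l ] (l ≤ k × Walk G x y l)

Code : Graph → Set₁
Code G = V G → Set

ErrorCorrecting : (G : Graph) → ℕ → Code G → Set
ErrorCorrecting G t D =
  ∀ x y → D x → D y → ¬ (x ≡ y) → ¬ DistLe G (2 * t) x y

Covers : (G : Graph) → ℕ → Code G → Set
Covers G r D = ∀ v → ∃[ c ] (D c × DistLe G r v c)

CoveringRadius : (G : Graph) → Code G → ℕ → Set
CoveringRadius G D zero    = Covers G zero D
CoveringRadius G D (suc r) = Covers G (suc r) D × ¬ Covers G r D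

QuasiPerfect : (G : Graph) → ℕ → Code G → Set
QuasiPerfect G t D = ErrorCorrecting G t D × CoveringRadius G D (suc t)

-- In a grid P m □ P n the graph distance is the ℓ¹ distance of coordinates, so
-- both claims become arithmetic about codes in ℕ².
-- (i) In the (2e+3) × (2e+3) grid take the four corners and the centre (h , h),
-- h = e + 1.  Distinct codewords are at distance ≥ 2h.  For each coordinate i the
-- distance to the nearer end plus the distance to h is h, so the distances of a
-- vertex to its nearest corner and to the centre add up to 2h and one of them is
-- at most h.  The vertex (0 , h) is at distance ≥ h from every codeword.
-- (ii) In the (e+1) × (e+3) grid take two opposite corners: they are 2e+2 apart,
-- the distances of any vertex to them add up to 2e+2, and (0 , e+1) is at
-- distance e+1 from both.

module Submission where

open import Defs
open import Data.Nat using (ℕ; zero; suc; _+_; _*_; _∸_; _≤_; _<_; ∣_-_∣; z≤n; s≤s; _≤?_)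
open import Data.Nat.Properties
open import Data.Nat.Tactic.RingSolver using (solve-∀)
open import Algebra.Properties.CommutativeSemigroup +-commutativeSemigroup using (interchange)
open import Data.Fin using (Fin; zero; suc; toℕ; fromℕ<)
open import Data.Fin.Properties using (toℕ-injective; toℕ-fromℕ<; toℕ<n)
open import Data.Product using (_×_; _,_; ∃-syntax; proj₁; proj₂)
open import Data.Sum using (_⊎_; inj₁; inj₂; swap)
open import Data.Empty using (⊥-elim)
open import Function using (_∘_)
open import Relation.Nullary using (¬_; yes; no)
open import Relation.Binary.PropositionalEquality

∣n-1+n∣≡1 : ∀ n → ∣ n - suc n ∣ ≡ 1
∣n-1+n∣≡1 n = trans (m≤n⇒∣m-n∣≡n∸m (n≤1+n n)) (m+n∸n≡m 1 n)

∣i-a∣+∣i-b∣≡b∸a : ∀ {a i b} → a ≤ i → i ≤ b → ∣ i - a ∣ + ∣ i - b ∣ ≡ b ∸ a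
∣i-a∣+∣i-b∣≡b∸a {a} {i} {b} a≤i i≤b = begin
  ∣ i - a ∣ + ∣ i - b ∣  ≡⟨ cong₂ _+_ (m≤n⇒∣n-m∣≡n∸m a≤i) (m≤n⇒∣m-n∣≡n∸m i≤b) ⟩
  (i ∸ a) + (b ∸ i)      ≡⟨ +-comm (i ∸ a) (b ∸ i) ⟩
  (b ∸ i) + (i ∸ a)      ≡⟨ +-∸-assoc (b ∸ i) a≤i ⟨
  (b ∸ i) + i ∸ a        ≡⟨ cong (_∸ a) (m∸n+n≡m i≤b) ⟩
  b ∸ a                  ∎
  where open ≡-Reasoning

m+n≡o+o⇒m≤o⊎n≤o : ∀ {m n o} → m + n ≡ o + o → m ≤ o ⊎ n ≤ o
m+n≡o+o⇒m≤o⊎n≤o {m} {n} {o} eq with m ≤? o | n ≤? o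
... | yes m≤o | _       = inj₁ m≤o
... | no _    | yes n≤o = inj₂ n≤o
... | no m≰o  | no n≰o  = ⊥-elim (<-irrefl (sym eq) (+-mono-< (≰⇒> m≰o) (≰⇒> n≰o)))

2*n<[1+n]+[1+n] : ∀ n → 2 * n < suc n + suc n
2*n<[1+n]+[1+n] n = s≤s (+-monoʳ-≤ n (≤-trans (≤-reflexive (+-identityʳ n)) (n≤1+n n)))

dist₁ : ℕ × ℕ → ℕ × ℕ → ℕ
dist₁ (a , b) (c , d) = ∣ a - c ∣ + ∣ b - d ∣

dist₁-comm : ∀ p q → dist₁ p q ≡ dist₁ q p
dist₁-comm (a , b) (c , d) = cong₂ _+_ (∣-∣-comm a c) (∣-∣-comm b d)

module _ {G : Graph} where

  _++ʷ_ : ∀ {x y z k l} → Walk G x y k → Walk G y z l → Walk G x z (k + l)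
  here       ++ʷ w = w
  step adj v ++ʷ w = step adj (v ++ʷ w)

  snoc : ∀ {x y z k} → Walk G x y k → Adj G y z → Walk G x z (suc k)
  snoc here         adj = step adj here
  snoc (step a w) adj = step a (snoc w adj)

  reverse : (∀ {x y} → Adj G x y → Adj G y x) → ∀ {x y k} → Walk G x y k → Walk G y x k
  reverse sym-adj here         = here
  reverse sym-adj (step adj w) = snoc (reverse sym-adj w) (sym-adj adj)

module _ {G H : Graph} where

  □-walkˡ : ∀ {g g' : V G} {h : V H} {k} → Walk G g g' k → Walk (G □ H) (g , h) (g' , h) k
  □-walkˡ here         = here
  □-walkˡ (step adj w) = step (inj₁ (refl , adj)) (□-walkˡ w)

  □-walkʳ : ∀ {g : V G} {h h' : V H} {k} → Walk H h h' k → Walk (G □ H) (g , h) (g , h') k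
  □-walkʳ here         = here
  □-walkʳ (step adj w) = step (inj₂ (refl , adj)) (□-walkʳ w)

P-walk-suc : ∀ {n} {x y : Fin n} {k} → Walk (P n) x y k → Walk (P (suc n)) (suc x) (suc y) k
P-walk-suc here         = here
P-walk-suc (step adj w) = step (Data.Sum.map (cong suc) (cong suc) adj) (P-walk-suc w)

P-walk-up : ∀ {n} (y : Fin n) → Walk (P (suc n)) zero (suc y) (suc (toℕ y))
P-walk-up zero    = step (inj₁ refl) here
P-walk-up (suc y) = step (inj₁ refl) (P-walk-suc (P-walk-up y))

P-walk : ∀ {n} (x y : Fin n) → Walk (P n) x y ∣ toℕ x - toℕ y ∣
P-walk zero    zero    = here
P-walk zero    (suc y) = P-walk-up y
P-walk (suc x) zero    = reverse swap (P-walk-up x)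
P-walk (suc x) (suc y) = P-walk-suc (P-walk x y)

P-adj⇒∣-∣≡1 : ∀ {n} {i j : Fin n} → Adj (P n) i j → ∣ toℕ i - toℕ j ∣ ≡ 1
P-adj⇒∣-∣≡1 {i = i} (inj₁ eq) = subst (λ k → ∣ toℕ i - k ∣ ≡ 1) eq (∣n-1+n∣≡1 (toℕ i))
P-adj⇒∣-∣≡1 {j = j} (inj₂ eq) =
  subst (λ k → ∣ k - toℕ j ∣ ≡ 1) eq (trans (∣-∣-comm (suc (toℕ j)) (toℕ j)) (∣n-1+n∣≡1 (toℕ j)))

P-adj⇒∣-∣≤ : ∀ {n} {i j : Fin n} → Adj (P n) i j → ∀ k → ∣ toℕ i - k ∣ ≤ suc ∣ toℕ j - k ∣
P-adj⇒∣-∣≤ {i = i} {j} adj k =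
  ≤-trans (∣-∣-triangle (toℕ i) (toℕ j) k) (≤-reflexive (cong (_+ ∣ toℕ j - k ∣) (P-adj⇒∣-∣≡1 adj)))

module _ {m n : ℕ} where

  coords : Fin m × Fin n → ℕ × ℕ
  coords (x , y) = toℕ x , toℕ y

  coords-injective : ∀ {u w} → coords u ≡ coords w → u ≡ w
  coords-injective eq = cong₂ _,_ (toℕ-injective (cong proj₁ eq)) (toℕ-injective (cong proj₂ eq))

  dist₁-adj : ∀ {u v} → Adj (P m □ P n) u v → ∀ q → dist₁ (coords u) q ≤ suc (dist₁ (coords v) q)
  dist₁-adj (inj₁ (refl , adj)) (c , d) = +-monoˡ-≤ _ (P-adj⇒∣-∣≤ adj c)
  dist₁-adj (inj₂ (refl , adj)) (c , d) =
    ≤-trans (+-monoʳ-≤ _ (P-adj⇒∣-∣≤ adj d)) (≤-reflexive (+-suc _ _))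

  dist₁≤length : ∀ {u w l} → Walk (P m □ P n) u w l → dist₁ (coords u) (coords w) ≤ l
  dist₁≤length {u = x , y} here = ≤-reflexive (cong₂ _+_ (∣n-n∣≡0 (toℕ x)) (∣n-n∣≡0 (toℕ y)))
  dist₁≤length {w = w} (step adj walk) = ≤-trans (dist₁-adj adj (coords w)) (s≤s (dist₁≤length walk))

  grid-walk : ∀ u w → Walk (P m □ P n) u w (dist₁ (coords u) (coords w))
  grid-walk (x , y) (x' , y') = □-walkˡ (P-walk x x') ++ʷ □-walkʳ (P-walk y y')

  distLe⇒dist₁≤ : ∀ {k u w} → DistLe (P m □ P n) k u w → dist₁ (coords u) (coords w) ≤ k
  distLe⇒dist₁≤ (_ , l≤k , walk) = ≤-trans (dist₁≤length walk) l≤k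

  dist₁≤⇒distLe : ∀ {k u w} → dist₁ (coords u) (coords w) ≤ k → DistLe (P m □ P n) k u w
  dist₁≤⇒distLe {u = u} {w} le = _ , le , grid-walk u w

InGrid : ℕ → ℕ → ℕ × ℕ → Set
InGrid m n (i , j) = i < m × j < n

coords-inGrid : ∀ {m n} (u : Fin m × Fin n) → InGrid m n (coords u)
coords-inGrid (x , y) = toℕ<n x , toℕ<n y

inGrid⇒vertex : ∀ {m n p} → InGrid m n p → ∃[ u ] coords {m} {n} u ≡ p
inGrid⇒vertex (i<m , j<n) = (fromℕ< i<m , fromℕ< j<n) , cong₂ _,_ (toℕ-fromℕ< i<m) (toℕ-fromℕ< j<n)

quasiPerfect-byDist₁ : ∀ {m n} t (C : ℕ × ℕ → Set) →
  (∀ {p q} → C p → C q → p ≢ q → 2 * t < dist₁ p q) →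
  (∀ {p} → InGrid m n p → ∃[ q ] (C q × InGrid m n q × dist₁ p q ≤ suc t)) →
  (∃[ p ] (InGrid m n p × (∀ {q} → C q → t < dist₁ p q))) →
  QuasiPerfect (P m □ P n) t (C ∘ coords)
quasiPerfect-byDist₁ {m} {n} t C separated covered (_ , p∈ , hole) with inGrid⇒vertex p∈
... | v , refl = errorCorrecting , covers , notCovers
  where
  errorCorrecting : ErrorCorrecting (P m □ P n) t (C ∘ coords)
  errorCorrecting u w Cu Cw u≢w near =
    <⇒≱ (separated Cu Cw (u≢w ∘ coords-injective)) (distLe⇒dist₁≤ near)

  covers : Covers (P m □ P n) (suc t) (C ∘ coords)
  covers u with covered (coords-inGrid u)
  ... | _ , Cq , q∈ , close with inGrid⇒vertex q∈
  ...   | c , refl = c , Cq , dist₁≤⇒distLe close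

  notCovers : ¬ Covers (P m □ P n) t (C ∘ coords)
  notCovers cover with cover v
  ... | c , Cc , near = <⇒≱ (hole Cc) (distLe⇒dist₁≤ near)

nearer-of-two : ∀ {C : ℕ × ℕ → Set} {m n p q₁ q₂ r} →
  C q₁ → C q₂ → InGrid m n q₁ → InGrid m n q₂ → dist₁ p q₁ + dist₁ p q₂ ≡ r + r →
  ∃[ q ] (C q × InGrid m n q × dist₁ p q ≤ r)
nearer-of-two {q₁ = q₁} {q₂} C₁ C₂ q₁∈ q₂∈ sum with m+n≡o+o⇒m≤o⊎n≤o sum
... | inj₁ close = q₁ , C₁ , q₁∈ , close
... | inj₂ close = q₂ , C₂ , q₂∈ , close

module CornersAndCentre (t : ℕ) where

  h : ℕ
  h = suc t

  End : ℕ → Set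
  End a = a ≡ 0 ⊎ a ≡ h + h

  Codeword : ℕ × ℕ → Set
  Codeword (a , b) = End a × End b ⊎ (a , b) ≡ (h , h)

  side≡ : 2 * t + 3 ≡ suc (h + h)
  side≡ = lemma t
    where
    lemma : ∀ t → 2 * t + 3 ≡ suc (suc t + suc t)
    lemma = solve-∀

  <side⇒≤h+h : ∀ {i} → i < 2 * t + 3 → i ≤ h + h
  <side⇒≤h+h {i} i< = ≤-pred (subst (i <_) side≡ i<)

  ≤h+h⇒<side : ∀ {i} → i ≤ h + h → i < 2 * t + 3
  ≤h+h⇒<side {i} i≤ = subst (i <_) (sym side≡) (s≤s i≤)

  End≤h+h : ∀ {a} → End a → a ≤ h + h
  End≤h+h (inj₁ refl) = z≤n
  End≤h+h (inj₂ refl) = ≤-refl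

  End-∣-∣ : ∀ {a c} → End a → End c → a ≡ c ⊎ ∣ a - c ∣ ≡ h + h
  End-∣-∣ (inj₁ refl) (inj₁ refl) = inj₁ refl
  End-∣-∣ (inj₁ refl) (inj₂ refl) = inj₂ refl
  End-∣-∣ (inj₂ refl) (inj₁ refl) = inj₂ (∣-∣-identityʳ (h + h))
  End-∣-∣ (inj₂ refl) (inj₂ refl) = inj₁ refl

  End-∣-h∣ : ∀ {a} → End a → ∣ a - h ∣ ≡ h
  End-∣-h∣ (inj₁ refl) = refl
  End-∣-h∣ (inj₂ refl) = trans (m≤n⇒∣n-m∣≡n∸m (m≤m+n h h)) (m+n∸m≡n h h)

  nearestEnd : ∀ {i} → i ≤ h + h → ∃[ a ] (End a × ∣ i - a ∣ + ∣ i - h ∣ ≡ h)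
  nearestEnd {i} i≤2h with i ≤? h
  ... | yes i≤h = 0 , inj₁ refl , ∣i-a∣+∣i-b∣≡b∸a z≤n i≤h
  ... | no i≰h  = h + h , inj₂ refl , (begin
    ∣ i - (h + h) ∣ + ∣ i - h ∣  ≡⟨ +-comm ∣ i - (h + h) ∣ ∣ i - h ∣ ⟩
    ∣ i - h ∣ + ∣ i - (h + h) ∣  ≡⟨ ∣i-a∣+∣i-b∣≡b∸a (<⇒≤ (≰⇒> i≰h)) i≤2h ⟩
    (h + h) ∸ h                  ≡⟨ m+n∸m≡n h h ⟩
    h                            ∎)
    where open ≡-Reasoning

  far-apart : ∀ {p q} → Codeword p → Codeword q → p ≢ q → h + h ≤ dist₁ p q
  far-apart (inj₁ (Ea , Eb)) (inj₁ (Ec , Ed)) p≢q with End-∣-∣ Ea Ec | End-∣-∣ Eb Ed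
  ... | inj₁ refl | inj₁ refl = ⊥-elim (p≢q refl)
  ... | inj₂ ac   | _         = ≤-trans (≤-reflexive (sym ac)) (m≤m+n _ _)
  ... | inj₁ _    | inj₂ bd   = ≤-trans (≤-reflexive (sym bd)) (m≤n+m _ _)
  far-apart (inj₁ (Ea , Eb)) (inj₂ refl) _ = ≤-reflexive (sym (cong₂ _+_ (End-∣-h∣ Ea) (End-∣-h∣ Eb)))
  far-apart {p} {q} (inj₂ refl) Cq@(inj₁ _) p≢q =
    subst (h + h ≤_) (dist₁-comm q p) (far-apart Cq (inj₂ refl) (p≢q ∘ sym))
  far-apart (inj₂ refl) (inj₂ refl) p≢q = ⊥-elim (p≢q refl)

  separated : ∀ {p q} → Codeword p → Codeword q → p ≢ q → 2 * t < dist₁ p q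
  separated Cp Cq p≢q = <-≤-trans (2*n<[1+n]+[1+n] t) (far-apart Cp Cq p≢q)

  covered : ∀ {p} → InGrid (2 * t + 3) (2 * t + 3) p →
    ∃[ q ] (Codeword q × InGrid (2 * t + 3) (2 * t + 3) q × dist₁ p q ≤ h)
  covered {i , j} (i< , j<) with nearestEnd (<side⇒≤h+h i<) | nearestEnd (<side⇒≤h+h j<)
  ... | a , Ea , ia | b , Eb , jb =
    nearer-of-two {p = i , j} (inj₁ (Ea , Eb)) (inj₂ refl)
      (≤h+h⇒<side (End≤h+h Ea) , ≤h+h⇒<side (End≤h+h Eb))
      (≤h+h⇒<side (m≤m+n h h) , ≤h+h⇒<side (m≤m+n h h))
      (trans (interchange ∣ i - a ∣ ∣ j - b ∣ ∣ i - h ∣ ∣ j - h ∣) (cong₂ _+_ ia jb))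

  hole : ∀ {q} → Codeword q → t < dist₁ (0 , h) q
  hole {a , b} (inj₁ (_ , Eb)) = ≤-trans (≤-reflexive (sym (trans (∣-∣-comm h b) (End-∣-h∣ Eb)))) (m≤n+m _ a)
  hole         (inj₂ refl)     = m≤m+n h _

  quasiPerfect : ∃[ D ] QuasiPerfect (P (2 * t + 3) □ P (2 * t + 3)) t D
  quasiPerfect = _ , quasiPerfect-byDist₁ t Codeword separated covered
    ((0 , h) , (≤h+h⇒<side z≤n , ≤h+h⇒<side (m≤m+n h h)) , hole)

module OppositeCorners (t : ℕ) where

  Codeword : ℕ × ℕ → Set
  Codeword p = p ≡ (0 , 0) ⊎ p ≡ (t , 2 + t)

  corners-dist : dist₁ (0 , 0) (t , 2 + t) ≡ suc t + suc t
  corners-dist = +-suc t (suc t)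

  <t+1⇒≤t : ∀ {i} → i < t + 1 → i ≤ t
  <t+1⇒≤t {i} i< = ≤-pred (subst (i <_) (+-comm t 1) i<)

  ≤t⇒<t+1 : ∀ {i} → i ≤ t → i < t + 1
  ≤t⇒<t+1 {i} i≤ = subst (i <_) (+-comm 1 t) (s≤s i≤)

  <t+3⇒≤2+t : ∀ {j} → j < t + 3 → j ≤ 2 + t
  <t+3⇒≤2+t {j} j< = ≤-pred (subst (j <_) (+-comm t 3) j<)

  ≤2+t⇒<t+3 : ∀ {j} → j ≤ 2 + t → j < t + 3
  ≤2+t⇒<t+3 {j} j≤ = subst (j <_) (+-comm 3 t) (s≤s j≤)

  separated : ∀ {p q} → Codeword p → Codeword q → p ≢ q → 2 * t < dist₁ p q
  separated (inj₁ refl) (inj₁ refl) p≢q = ⊥-elim (p≢q refl)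
  separated (inj₁ refl) (inj₂ refl) _ = <-≤-trans (2*n<[1+n]+[1+n] t) (≤-reflexive (sym corners-dist))
  separated (inj₂ refl) (inj₁ refl) _ =
    <-≤-trans (2*n<[1+n]+[1+n] t) (≤-reflexive (sym (trans (dist₁-comm (t , 2 + t) (0 , 0)) corners-dist)))
  separated (inj₂ refl) (inj₂ refl) p≢q = ⊥-elim (p≢q refl)

  covered : ∀ {p} → InGrid (t + 1) (t + 3) p →
    ∃[ q ] (Codeword q × InGrid (t + 1) (t + 3) q × dist₁ p q ≤ suc t)
  covered {i , j} (i< , j<) =
    nearer-of-two {p = i , j} (inj₁ refl) (inj₂ refl)
      (≤t⇒<t+1 z≤n , ≤2+t⇒<t+3 z≤n) (≤t⇒<t+1 ≤-refl , ≤2+t⇒<t+3 ≤-refl)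
      (trans (interchange ∣ i - 0 ∣ ∣ j - 0 ∣ ∣ i - t ∣ ∣ j - (2 + t) ∣)
        (trans (cong₂ _+_ (∣i-a∣+∣i-b∣≡b∸a z≤n (<t+1⇒≤t i<)) (∣i-a∣+∣i-b∣≡b∸a z≤n (<t+3⇒≤2+t j<)))
               corners-dist))

  hole : ∀ {q} → Codeword q → t < dist₁ (0 , suc t) q
  hole (inj₁ refl) = n<1+n t
  hole (inj₂ refl) = ≤-reflexive (sym (trans (cong (t +_) (∣n-1+n∣≡1 t)) (+-comm t 1)))

  quasiPerfect : ∃[ D ] QuasiPerfect (P (t + 1) □ P (t + 3)) t D
  quasiPerfect = _ , quasiPerfect-byDist₁ t Codeword separated covered
    ((0 , suc t) , (≤t⇒<t+1 z≤n , ≤2+t⇒<t+3 (n≤1+n (suc t))) , hole)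

theorem12 : (e m n : ℕ) → 1 ≤ e → 2 ≤ m → m ≤ n →
    ((m ≡ 2 * e + 3 × n ≡ 2 * e + 3) ⊎ (m ≡ e + 1 × n ≡ e + 3)) →
    ∃[ D ] QuasiPerfect (P m □ P n) e D
theorem12 e _ _ _ _ _ (inj₁ (refl , refl)) = CornersAndCentre.quasiPerfect e
theorem12 e _ _ _ _ _ (inj₂ (refl , refl)) = OppositeCorners.quasiPerfect e
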